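{- Let $p\geq 1$ be an integer and let $(a_n^{(k)})_{n\in\mathbb{Z}}$, $0\leq k\leq p$, be bi-infinite sequences of complex numbers. With the lattice paths, weights and formal power series defined in the context, the following identities hold in the field $\mathbb{C}((z^{ -1}))$: \[ A_{0}(z)=\frac{1}{z-a_{0}^{(0)}-\sum_{j=1}^{p}a_{0}^{(j)}\,A_{j-1}^{(1)}(z)},\qquad A_{j}(z)=A_{0}(z)\,A^{(1)}_{j-1}(z)\quad (1\leq j\leq p). \]
   Context: $\mathbb{C}((z^{ -1}))$ denotes the field of formal series $\sum_{n\in\mathbb{Z}} c_n z^{ -n}$ with complex coefficients and only finitely many nonzero $c_n$ with $n<0$. Lattice paths have vertices in $\mathbb{Z}_{\geq 0}\times\mathbb{Z}$ and are finite sequences of steps, consecutive steps sharing endpoints; the allowed steps are upsteps $(n,m)\to(n+1,m+1)$, level steps $(n,m)\to(n+1,m)$, and downsteps $(n,m)\to(n+1,m-j)$ with $1\leq j\leq p$. The length of a path is its number of steps (a path of length $0$ is a single vertex). Weights: every upstep has weight $1$; a step $(n,m)\to(n+1,m-j)$ with $0\leq j\leq p$ has weight $a_{m-j}^{(j)}$. The weight $w(\gamma)$ of a path is the product of the weights of its steps ($1$ for a path of length $0$). For an integer $q$, $\gamma+q$ denotes the path shifted vertically by $q$ units. $\min(\gamma)$ is the minimal height (second coordinate) of the vertices of $\gamma$. For $n\geq0$ and $0\leq j\leq p$, $\mathcal{D}_{[n,j]}$ is the set of paths of length $n$ from $(0,0)$ to $(n,j)$ with $\min(\gamma)=0$. For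 integers $q\geq 0$ put $A_{[n,j]}^{(q)}=\sum_{\gamma\in\mathcal{D}_{[n,j]}}w(\gamma+q)$ (an empty sum is $0$), $A_{[n,j]}=A_{[n,j]}^{(0)}$, and define the formal series $A_j^{(q)}(z)=\sum_{n=0}^\infty A^{(q)}_{[n,j]}z^{ -n-1}$, $A_j(z)=A_j^{(0)}(z)$. -}

module Defs where

open import Level using (Level)
open import Algebra.Bundles using (CommutativeRing)
open import Data.Nat as ℕ using (ℕ; zero; suc; _⊔_; _∸_)
open import Data.Integer as ℤ using (ℤ; +_; -[1+_]; _⊓_)
open import Data.Fin using (Fin; toℕ)
open import Data.Vec using (Vec; []; _∷_)
open import Data.List using (List; []; _∷_; map; concatMap; foldr)
open import Data.List.Base using () renaming (allFin to allFinL)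
open import Data.Bool using (if_then_else_)
open import Relation.Nullary using (does)
open import Relation.Nullary.Decidable using (_×-dec_)

-- Lattice paths with steps: up (+1), and (st j) : down by j, 0 ≤ j ≤ p
-- (st zero is the level step).

data Step (p : ℕ) : Set where
  up : Step p
  st : Fin (suc p) → Step p

Δ : ∀ {p} → Step p → ℤ
Δ up     = + 1
Δ (st j) = ℤ.- (+ toℕ j)

allSteps : (p : ℕ) → List (Step p)
allSteps p = up ∷ map st (allFinL (suc p))

-- a path of length n starting at a given height is a vector of n steps;
-- all paths of length n (as step sequences)
allPaths : (p n : ℕ) → List (Vec (Step p) n)
allPaths p zero    = [] ∷ []
allPaths p (suc n) = concatMap (λ s → map (s ∷_) (allPaths p n)) (allSteps p)

endHeight : ∀ {p n} → ℤ → Vec (Step p) n → ℤ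
endHeight h []      = h
endHeight h (s ∷ γ) = endHeight (h ℤ.+ Δ s) γ

minHeight : ∀ {p n} → ℤ → Vec (Step p) n → ℤ
minHeight h []      = h
minHeight h (s ∷ γ) = h ⊓ minHeight (h ℤ.+ Δ s) γ

-- Formal Laurent series in z⁻¹ over a commutative ring.
-- An element  (N , c)  represents  Σ_{k ≥ 0} c k · z^(N - k).

module Laurent {c ℓ : Level} (R : CommutativeRing c ℓ) where
  open CommutativeRing R

  record Ser : Set c where
    constructor mk
    field
      top : ℕ
      cf  : ℕ → Carrier
  open Ser public

  coeffAt : Ser → ℤ → Carrier
  coeffAt f e with + top f ℤ.- e
  ... | + k      = cf f k
  ... | -[1+ _ ] = 0#

  _≋_ : Ser → Ser → Set ℓ
  f ≋ g = ∀ e → coeffAt f e ≈ coeffAt g e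
  infix 4 _≋_

  sumBelow : (ℕ → Carrier) → ℕ → Carrier
  sumBelow f zero    = 0#
  sumBelow f (suc n) = sumBelow f n + f n

  pad : ℕ → (ℕ → Carrier) → ℕ → Carrier
  pad zero    g k       = g k
  pad (suc s) g zero    = 0#
  pad (suc s) g (suc k) = pad s g k

  _⊕_ : Ser → Ser → Ser
  f ⊕ g = mk N (λ k → pad (N ∸ top f) (cf f) k + pad (N ∸ top g) (cf g) k)
    where N = top f ⊔ top g
  infixl 6 _⊕_

  ⊝_ : Ser → Ser
  ⊝ f = mk (top f) (λ k → - cf f k)

  _⊖_ : Ser → Ser → Ser
  f ⊖ g = f ⊕ (⊝ g)
  infixl 6 _⊖_

  _⊗_ : Ser → Ser → Ser
  f ⊗ g = mk (top f ℕ.+ top g) (λ k → sumBelow (λ i → cf f i * cf g (k ∸ i)) (suc k))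
  infixl 7 _⊗_

  const : Carrier → Ser
  const a = mk 0 λ { zero → a ; (suc _) → 0# }

  𝟘 𝟙 : Ser
  𝟘 = const 0#
  𝟙 = const 1#

  Z : Ser
  Z = mk 1 λ { zero → 1# ; (suc _) → 0# }

  ΣL : List Ser → Ser
  ΣL = foldr _⊕_ 𝟘

-- Path weights and the series A_j^{(q)}(z).
-- a j m  stands for  a_m^{(j)}.

module PathSeries {c ℓ : Level} (R : CommutativeRing c ℓ) (p : ℕ)
                  (a : Fin (suc p) → ℤ → CommutativeRing.Carrier R) where
  open CommutativeRing R
  open Laurent R public

  stepWeight : ℤ → Step p → Carrier
  stepWeight m up     = 1#
  stepWeight m (st j) = a j (m ℤ.- + toℕ j)

  -- weight of the path with the given steps starting at height h;
  -- w(γ + q) is  weight (+ q) γ  for γ starting at (0,0)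
  weight : ∀ {n} → ℤ → Vec (Step p) n → Carrier
  weight h []      = 1#
  weight h (s ∷ γ) = stepWeight h s * weight (h ℤ.+ Δ s) γ

  -- A^{(q)}_{[n,j]} = Σ_{γ ∈ D_{[n,j]}} w(γ + q), where D_{[n,j]} are the
  -- paths from (0,0) to (n,j) with min(γ) = 0
  Acoef : ℕ → Fin (suc p) → ℕ → Carrier
  Acoef n j q = foldr _+_ 0#
    (map (λ γ → if does ((endHeight (+ 0) γ ℤ.≟ + toℕ j) ×-dec (minHeight (+ 0) γ ℤ.≟ + 0))
                then weight (+ q) γ else 0#)
         (allPaths p n))

  -- A_j^{(q)}(z) = Σ_{n ≥ 0} A^{(q)}_{[n,j]} z^{-n-1}
  Aser : Fin (suc p) → ℕ → Ser
  Aser j q = mk 0 λ { zero → 0# ; (suc n) → Acoef n j q }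

-- Write W b n h e for the total weight of the length-n paths from height h to height e that never
-- go below b; translating a path by q shows A^{(q)}_{[n,j]} = W q n q (q + j). Cutting a path from
-- 0 to j ≥ 1 at its last visit to level 0, which it must leave by an up-step, gives
-- A_{[n,j]} = Σ_{l+1+k=n} A_{[l,0]} A^{(1)}_{[k,j-1]}, that is A_j = A_0 A^{(1)}_{j-1}.
-- A path from 0 to 0 of positive length starts with a level step or an up-step; after an up-step it
-- first returns to level 0 by a down-step of some size j from height j, and cutting there gives
-- A_{[n+1,0]} = a_0^{(0)} A_{[n,0]} + Σ_j a_0^{(j)} Σ_{k+1+l=n} A^{(1)}_{[k,j-1]} A_{[l,0]},
-- the coefficientwise form of A_0 (z - a_0^{(0)} - Σ_j a_0^{(j)} A^{(1)}_{j-1}) = 1.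

module Submission where

open import Defs
open import Level using (Level)
open import Algebra.Bundles using (CommutativeRing)
open import Data.Nat using (ℕ; _≤_)
open import Data.Integer using (ℤ; +_)
open import Data.Fin using (Fin; zero; suc; inject₁)
open import Data.List using (map)
open import Data.List.Base using (allFin)
open import Data.Product using (_×_)

open import Data.Bool using (Bool; true; false; if_then_else_; _∧_)
open import Data.Bool.Properties using (∧-zeroʳ)
open import Data.Fin using (toℕ)
open import Data.Fin.Properties using (toℕ-inject₁)
open import Data.Integer as ℤ using (-[1+_]; 0ℤ; 1ℤ; _≤?_; _≟_; _⊓_; +≤+)
import Data.Integer.Properties as ℤP
open import Algebra.Properties.AbelianGroup ℤP.+-0-abelianGroup
  using (\\-leftDividesʳ; ∙-cancelˡ; //-rightDividesˡ; //-rightDividesʳ)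
open import Data.List using (List; []; _∷_; foldr; concatMap; _++_; tabulate)
import Data.List.Properties as ListP
open import Data.Nat as ℕ using (zero; suc; _∸_; _<_; z≤n; s≤s)
import Data.Nat.Properties as ℕP
open import Data.Product using (_,_)
open import Data.Vec using (Vec; []; _∷_)
open import Function using (_∘_; _∘′_; _⇔_; mk⇔)
open import Relation.Nullary using (Dec; yes; no; does; ¬_)
open import Relation.Nullary.Decidable using (dec-true; dec-false; does-⇔)
import Relation.Binary.PropositionalEquality as ≡
open ≡ using (_≡_; _≢_)

private variable X Y : Set

+-cancelˡ-≤ : ∀ x {a b} → x ℤ.+ a ℤ.≤ x ℤ.+ b → a ℤ.≤ b
+-cancelˡ-≤ x {a} {b} le =
  ≡.subst₂ ℤ._≤_ (\\-leftDividesʳ x a) (\\-leftDividesʳ x b) (ℤP.+-monoʳ-≤ (ℤ.- x) le)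

i+1≰i : ∀ i → ¬ (i ℤ.+ 1ℤ ℤ.≤ i)
i+1≰i i le = ℤP.i≮i (ℤP.suc[i]≤j⇒i<j (≡.subst (ℤ._≤ i) (ℤP.+-comm i 1ℤ) le))

i≤i+1 : ∀ i → i ℤ.≤ i ℤ.+ 1ℤ
i≤i+1 i = ℤP.i≤i+j i 1ℤ

≤∧≢⇒+1≤ : ∀ {i j} → i ℤ.≤ j → j ≢ i → i ℤ.+ 1ℤ ℤ.≤ j
≤∧≢⇒+1≤ {i} i≤j j≢i =
  ≡.subst (ℤ._≤ _) (ℤP.+-comm 1ℤ i) (ℤP.i<j⇒suc[i]≤j (ℤP.≤∧≢⇒< i≤j (j≢i ∘′ ≡.sym)))

module _ {p : ℕ} where

  endHeight-+ : ∀ {n} x h (γ : Vec (Step p) n) → endHeight (x ℤ.+ h) γ ≡ x ℤ.+ endHeight h γ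
  endHeight-+ x h []      = ≡.refl
  endHeight-+ x h (s ∷ γ) =
    ≡.trans (≡.cong (λ y → endHeight y γ) (ℤP.+-assoc x h (Δ s))) (endHeight-+ x (h ℤ.+ Δ s) γ)

  minHeight-+ : ∀ {n} x h (γ : Vec (Step p) n) → minHeight (x ℤ.+ h) γ ≡ x ℤ.+ minHeight h γ
  minHeight-+ x h []      = ≡.refl
  minHeight-+ x h (s ∷ γ) = begin
    (x ℤ.+ h) ⊓ minHeight (x ℤ.+ h ℤ.+ Δ s) γ
      ≡⟨ ≡.cong (λ y → (x ℤ.+ h) ⊓ minHeight y γ) (ℤP.+-assoc x h (Δ s)) ⟩
    (x ℤ.+ h) ⊓ minHeight (x ℤ.+ (h ℤ.+ Δ s)) γ
      ≡⟨ ≡.cong ((x ℤ.+ h) ⊓_) (minHeight-+ x (h ℤ.+ Δ s) γ) ⟩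
    (x ℤ.+ h) ⊓ (x ℤ.+ minHeight (h ℤ.+ Δ s) γ)
      ≡⟨ ℤP.mono-≤-distrib-⊓ (ℤP.+-monoʳ-≤ x) h _ ⟨
    x ℤ.+ (h ⊓ minHeight (h ℤ.+ Δ s) γ) ∎
    where open ≡.≡-Reasoning

  minHeight-≤ : ∀ {n} h (γ : Vec (Step p) n) → minHeight h γ ℤ.≤ h
  minHeight-≤ h []      = ℤP.≤-refl
  minHeight-≤ h (s ∷ γ) = ℤP.i⊓j≤i h _

  endHeight≡⇔ : ∀ {n} x j (γ : Vec (Step p) n) → endHeight 0ℤ γ ≡ j ⇔ endHeight x γ ≡ x ℤ.+ j
  endHeight≡⇔ x j γ = mk⇔ (λ eq → ≡.trans shift (≡.cong (λ y → x ℤ.+ y) eq))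
                          (λ eq → ∙-cancelˡ x _ _ (≡.trans (≡.sym shift) eq))
    where
    shift : endHeight x γ ≡ x ℤ.+ endHeight 0ℤ γ
    shift = ≡.trans (≡.cong (λ y → endHeight y γ) (≡.sym (ℤP.+-identityʳ x))) (endHeight-+ x 0ℤ γ)

  minHeight≡0⇔ : ∀ {n} x (γ : Vec (Step p) n) → minHeight 0ℤ γ ≡ 0ℤ ⇔ x ℤ.≤ minHeight x γ
  minHeight≡0⇔ x γ = mk⇔
    (λ eq → ℤP.≤-reflexive (≡.sym (≡.trans shift
              (≡.trans (≡.cong (λ y → x ℤ.+ y) eq) (ℤP.+-identityʳ x)))))
    (λ le → ℤP.≤-antisym (minHeight-≤ 0ℤ γ)
              (+-cancelˡ-≤ x (≡.subst₂ ℤ._≤_ (≡.sym (ℤP.+-identityʳ x)) shift le)))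
    where
    shift : minHeight x γ ≡ x ℤ.+ minHeight 0ℤ γ
    shift = ≡.trans (≡.cong (λ y → minHeight y γ) (≡.sym (ℤP.+-identityʳ x))) (minHeight-+ x 0ℤ γ)

module Sums {c ℓ : Level} (R : CommutativeRing c ℓ) where
  open CommutativeRing R
  open Laurent R
  open import Relation.Binary.Reasoning.Setoid setoid
  open import Algebra.Properties.CommutativeSemigroup +-commutativeSemigroup using (interchange)
  open import Algebra.Properties.Ring ring using (-0#≈0#; -‿+-comm; -‿distribˡ-*)

  -- Stated with foldr and map so that Acoef n j q is literally an lsum over allPaths p n.
  lsum : (X → Carrier) → List X → Carrier
  lsum f xs = foldr _+_ 0# (map f xs)

  lsum-cong : ∀ {f g : X → Carrier} xs → (∀ x → f x ≈ g x) → lsum f xs ≈ lsum g xs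
  lsum-cong []       f≈g = refl
  lsum-cong (x ∷ xs) f≈g = +-cong (f≈g x) (lsum-cong xs f≈g)

  lsum-zero : ∀ (f : X → Carrier) xs → (∀ x → f x ≈ 0#) → lsum f xs ≈ 0#
  lsum-zero f []       f≈0 = refl
  lsum-zero f (x ∷ xs) f≈0 = trans (+-cong (f≈0 x) (lsum-zero f xs f≈0)) (+-identityʳ 0#)

  lsum-+ : ∀ (f g : X → Carrier) xs → lsum (λ x → f x + g x) xs ≈ lsum f xs + lsum g xs
  lsum-+ f g []       = sym (+-identityʳ 0#)
  lsum-+ f g (x ∷ xs) = trans (+-cong refl (lsum-+ f g xs)) (interchange _ _ _ _)

  lsum-*ˡ : ∀ k (f : X → Carrier) xs → lsum (λ x → k * f x) xs ≈ k * lsum f xs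
  lsum-*ˡ k f []       = sym (zeroʳ k)
  lsum-*ˡ k f (x ∷ xs) = trans (+-cong refl (lsum-*ˡ k f xs)) (sym (distribˡ k _ _))

  lsum-*ʳ : ∀ k (f : X → Carrier) xs → lsum (λ x → f x * k) xs ≈ lsum f xs * k
  lsum-*ʳ k f []       = sym (zeroˡ k)
  lsum-*ʳ k f (x ∷ xs) = trans (+-cong refl (lsum-*ʳ k f xs)) (sym (distribʳ k _ _))

  lsum-++ : ∀ (f : X → Carrier) xs ys → lsum f (xs ++ ys) ≈ lsum f xs + lsum f ys
  lsum-++ f []       ys = sym (+-identityˡ _)
  lsum-++ f (x ∷ xs) ys = trans (+-cong refl (lsum-++ f xs ys)) (sym (+-assoc _ _ _))

  lsum-map : ∀ (f : Y → Carrier) (g : X → Y) xs → lsum f (map g xs) ≈ lsum (f ∘ g) xs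
  lsum-map f g xs = reflexive (≡.cong (foldr _+_ 0#) (≡.sym (ListP.map-∘ xs)))

  lsum-concatMap : ∀ (f : Y → Carrier) (g : X → List Y) xs →
                   lsum f (concatMap g xs) ≈ lsum (λ x → lsum f (g x)) xs
  lsum-concatMap f g []       = refl
  lsum-concatMap f g (x ∷ xs) = trans (lsum-++ f (g x) _) (+-cong refl (lsum-concatMap f g xs))

  lsum-comm : ∀ (F : X → Y → Carrier) xs ys →
              lsum (λ x → lsum (F x) ys) xs ≈ lsum (λ y → lsum (λ x → F x y) xs) ys
  lsum-comm F []       ys = sym (lsum-zero _ ys (λ _ → refl))
  lsum-comm F (x ∷ xs) ys = trans (+-cong refl (lsum-comm F xs ys)) (sym (lsum-+ _ _ ys))

  sumBelow-cong< : ∀ {f g : ℕ → Carrier} n → (∀ i → i < n → f i ≈ g i) → sumBelow f n ≈ sumBelow g n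
  sumBelow-cong< zero    f≈g = refl
  sumBelow-cong< (suc n) f≈g =
    +-cong (sumBelow-cong< n (λ i i<n → f≈g i (ℕP.m<n⇒m<1+n i<n))) (f≈g n (ℕP.n<1+n n))

  sumBelow-cong : ∀ {f g : ℕ → Carrier} n → (∀ i → f i ≈ g i) → sumBelow f n ≈ sumBelow g n
  sumBelow-cong n f≈g = sumBelow-cong< n (λ i _ → f≈g i)

  sumBelow-zero : ∀ (f : ℕ → Carrier) n → (∀ i → f i ≈ 0#) → sumBelow f n ≈ 0#
  sumBelow-zero f zero    f≈0 = refl
  sumBelow-zero f (suc n) f≈0 = trans (+-cong (sumBelow-zero f n f≈0) (f≈0 n)) (+-identityʳ 0#)

  sumBelow-+ : ∀ (f g : ℕ → Carrier) n → sumBelow (λ i → f i + g i) n ≈ sumBelow f n + sumBelow g n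
  sumBelow-+ f g zero    = sym (+-identityʳ 0#)
  sumBelow-+ f g (suc n) = trans (+-cong (sumBelow-+ f g n) refl) (interchange _ _ _ _)

  sumBelow-*ˡ : ∀ k (f : ℕ → Carrier) n → sumBelow (λ i → k * f i) n ≈ k * sumBelow f n
  sumBelow-*ˡ k f zero    = sym (zeroʳ k)
  sumBelow-*ˡ k f (suc n) = trans (+-cong (sumBelow-*ˡ k f n) refl) (sym (distribˡ k _ _))

  sumBelow-neg : ∀ (f : ℕ → Carrier) n → sumBelow (λ i → - f i) n ≈ - sumBelow f n
  sumBelow-neg f zero    = sym -0#≈0#
  sumBelow-neg f (suc n) = trans (+-cong (sumBelow-neg f n) refl) (-‿+-comm _ _)

  sumBelow-lsum : ∀ (F : ℕ → X → Carrier) xs n →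
                  sumBelow (λ i → lsum (F i) xs) n ≈ lsum (λ x → sumBelow (λ i → F i x) n) xs
  sumBelow-lsum F xs zero    = sym (lsum-zero _ xs (λ _ → refl))
  sumBelow-lsum F xs (suc n) = trans (+-cong (sumBelow-lsum F xs n) refl) (sym (lsum-+ _ _ xs))

  sumBelow-peel : ∀ (f : ℕ → Carrier) n → sumBelow f (suc n) ≈ f 0 + sumBelow (f ∘ suc) n
  sumBelow-peel f zero    = trans (+-identityˡ _) (sym (+-identityʳ _))
  sumBelow-peel f (suc n) = trans (+-cong (sumBelow-peel f n) refl) (+-assoc _ _ _)

  sumBelow-reverse : ∀ (f : ℕ → Carrier) m → sumBelow f (suc m) ≈ sumBelow (λ i → f (m ∸ i)) (suc m)
  sumBelow-reverse f zero    = refl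
  sumBelow-reverse f (suc m) = begin
    sumBelow f (suc m) + f (suc m)                          ≈⟨ +-comm _ _ ⟩
    f (suc m) + sumBelow f (suc m)                          ≈⟨ +-cong refl (sumBelow-reverse f m) ⟩
    f (suc m) + sumBelow (λ i → f (m ∸ i)) (suc m)          ≈⟨ sumBelow-peel (λ i → f (suc m ∸ i)) (suc m) ⟨
    sumBelow (λ i → f (suc m ∸ i)) (suc (suc m))            ∎

  -- conv n f g sums f l * g k over l + k + 1 ≡ n, so cf (F ⊗ G) m is conv (suc m) (cf F) (cf G).
  conv : ℕ → (ℕ → Carrier) → (ℕ → Carrier) → Carrier
  conv zero    f g = 0#
  conv (suc m) f g = sumBelow (λ i → f i * g (m ∸ i)) (suc m)

  conv-cong : ∀ n {f f′ g g′ : ℕ → Carrier} → (∀ i → f i ≈ f′ i) → (∀ i → g i ≈ g′ i) →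
              conv n f g ≈ conv n f′ g′
  conv-cong zero    f≈f′ g≈g′ = refl
  conv-cong (suc m) f≈f′ g≈g′ = sumBelow-cong (suc m) (λ i → *-cong (f≈f′ i) (g≈g′ (m ∸ i)))

  conv-zeroˡ : ∀ n (f g : ℕ → Carrier) → (∀ i → f i ≈ 0#) → conv n f g ≈ 0#
  conv-zeroˡ zero    f g f≈0 = refl
  conv-zeroˡ (suc m) f g f≈0 = sumBelow-zero _ (suc m) (λ i → trans (*-cong (f≈0 i) refl) (zeroˡ _))

  conv-+ˡ : ∀ n (f f′ g : ℕ → Carrier) → conv n (λ i → f i + f′ i) g ≈ conv n f g + conv n f′ g
  conv-+ˡ zero    f f′ g = sym (+-identityʳ 0#)
  conv-+ˡ (suc m) f f′ g = trans (sumBelow-cong (suc m) (λ i → distribʳ _ _ _)) (sumBelow-+ _ _ (suc m))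

  conv-*ˡ : ∀ n k (f g : ℕ → Carrier) → conv n (λ i → k * f i) g ≈ k * conv n f g
  conv-*ˡ zero    k f g = sym (zeroʳ k)
  conv-*ˡ (suc m) k f g = trans (sumBelow-cong (suc m) (λ i → *-assoc _ _ _)) (sumBelow-*ˡ k _ (suc m))

  conv-negˡ : ∀ n (f g : ℕ → Carrier) → conv n (λ i → - f i) g ≈ - conv n f g
  conv-negˡ zero    f g = sym -0#≈0#
  conv-negˡ (suc m) f g =
    trans (sumBelow-cong (suc m) (λ i → sym (-‿distribˡ-* _ _))) (sumBelow-neg _ (suc m))

  conv-lsumˡ : ∀ n (F : X → ℕ → Carrier) g xs →
               conv n (λ i → lsum (λ x → F x i) xs) g ≈ lsum (λ x → conv n (F x) g) xs
  conv-lsumˡ zero    F g xs = sym (lsum-zero _ xs (λ _ → refl))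
  conv-lsumˡ (suc m) F g xs = trans (sumBelow-cong (suc m) (λ i → sym (lsum-*ʳ _ _ xs)))
                                    (sumBelow-lsum _ xs (suc m))

  conv-peel : ∀ n (f g : ℕ → Carrier) → conv (suc n) f g ≈ f 0 * g n + conv n (f ∘ suc) g
  conv-peel zero    f g = trans (+-identityˡ _) (sym (+-identityʳ _))
  conv-peel (suc m) f g = sumBelow-peel (λ i → f i * g (suc m ∸ i)) (suc m)

  conv-comm : ∀ n (f g : ℕ → Carrier) → conv n f g ≈ conv n g f
  conv-comm zero    f g = refl
  conv-comm (suc m) f g = begin
    sumBelow (λ i → f i * g (m ∸ i)) (suc m)              ≈⟨ sumBelow-reverse _ m ⟩
    sumBelow (λ i → f (m ∸ i) * g (m ∸ (m ∸ i))) (suc m)  ≈⟨ sumBelow-cong< (suc m) m∸[m∸i]≡i ⟩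
    sumBelow (λ i → f (m ∸ i) * g i) (suc m)              ≈⟨ sumBelow-cong (suc m) (λ i → *-comm _ _) ⟩
    sumBelow (λ i → g i * f (m ∸ i)) (suc m)              ∎
    where
    m∸[m∸i]≡i : ∀ i → i < suc m → f (m ∸ i) * g (m ∸ (m ∸ i)) ≈ f (m ∸ i) * g i
    m∸[m∸i]≡i i i<1+m = *-cong refl (reflexive (≡.cong g (ℕP.m∸[m∸n]≡n (ℕ.s≤s⁻¹ i<1+m))))

  conv-suc-head : ∀ n (f g : ℕ → Carrier) → f 0 ≈ 0# → conv (suc n) f g ≈ conv n (f ∘ suc) g
  conv-suc-head n f g f0≈0 =
    trans (conv-peel n f g) (trans (+-cong (trans (*-cong f0≈0 refl) (zeroˡ _)) refl) (+-identityˡ _))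

  conv-suc-tail : ∀ n (f g : ℕ → Carrier) → g 0 ≈ 0# → conv (suc n) f g ≈ conv n f (g ∘ suc)
  conv-suc-tail n f g g0≈0 =
    trans (conv-comm (suc n) f g) (trans (conv-suc-head n g f g0≈0) (conv-comm n (g ∘ suc) f))

  conv-constˡ : ∀ n a (f : ℕ → Carrier) → conv (suc n) (cf (const a)) f ≈ a * f n
  conv-constˡ n a f = trans (conv-peel n (cf (const a)) f)
    (trans (+-cong refl (conv-zeroˡ n _ f (λ _ → refl))) (+-identityʳ _))

  atℤ : (ℕ → Carrier) → ℤ → Carrier
  atℤ f (+ k)     = f k
  atℤ f -[1+ _ ] = 0#

  coeffAt-mk : ∀ t f e → coeffAt (mk t f) e ≡.≡ atℤ f (+ t ℤ.- e)
  coeffAt-mk t f e with + t ℤ.- e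
  ... | + k      = ≡.refl
  ... | -[1+ _ ] = ≡.refl

  mk-cong : ∀ t {f g : ℕ → Carrier} → (∀ k → f k ≈ g k) → mk t f ≋ mk t g
  mk-cong t {f} {g} f≈g e = begin
    coeffAt (mk t f) e   ≡⟨ coeffAt-mk t f e ⟩
    atℤ f (+ t ℤ.- e)     ≈⟨ at-cong (+ t ℤ.- e) ⟩
    atℤ g (+ t ℤ.- e)     ≡⟨ coeffAt-mk t g e ⟨
    coeffAt (mk t g) e   ∎
    where
    at-cong : ∀ k → atℤ f k ≈ atℤ g k
    at-cong (+ k)     = f≈g k
    at-cong -[1+ _ ] = refl

  mk-suc : ∀ t (f g : ℕ → Carrier) → f 0 ≈ 0# → (∀ k → f (suc k) ≈ g k) → mk (suc t) f ≋ mk t g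
  mk-suc t f g f0≈0 f∘suc≈g e = begin
    coeffAt (mk (suc t) f) e   ≡⟨ coeffAt-mk (suc t) f e ⟩
    atℤ f (1ℤ ℤ.+ + t ℤ.- e)    ≡⟨ ≡.cong (atℤ f) (ℤP.+-assoc 1ℤ (+ t) (ℤ.- e)) ⟩
    atℤ f (1ℤ ℤ.+ (+ t ℤ.- e))  ≈⟨ at-suc (+ t ℤ.- e) ⟩
    atℤ g (+ t ℤ.- e)           ≡⟨ coeffAt-mk t g e ⟨
    coeffAt (mk t g) e         ∎
    where
    at-suc : ∀ k → atℤ f (1ℤ ℤ.+ k) ≈ atℤ g k
    at-suc (+ k)            = f∘suc≈g k
    at-suc -[1+ zero ]    = f0≈0
    at-suc -[1+ suc _ ]   = refl

  ≋⊗-fromConv : ∀ (c₀ c₁ c₂ : ℕ → Carrier) → c₀ 0 ≈ 0# → c₁ 0 ≈ 0# → c₂ 0 ≈ 0# →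
                (∀ n → c₂ (suc n) ≈ conv n (c₀ ∘ suc) (c₁ ∘ suc)) →
                mk 0 c₂ ≋ mk 0 c₀ ⊗ mk 0 c₁
  ≋⊗-fromConv c₀ c₁ c₂ c₀0≈0 c₁0≈0 c₂0≈0 c₂-suc = mk-cong 0 c₂≈c₀c₁
    where
    c₂≈c₀c₁ : ∀ k → c₂ k ≈ conv (suc k) c₀ c₁
    c₂≈c₀c₁ zero    = trans c₂0≈0 (sym (conv-suc-head 0 c₀ c₁ c₀0≈0))
    c₂≈c₀c₁ (suc n) = trans (c₂-suc n) (sym (trans (conv-suc-head (suc n) c₀ c₁ c₀0≈0)
                                                    (conv-suc-tail n (c₀ ∘ suc) c₁ c₁0≈0)))

  -- The product has top degree 1 and vanishing leading coefficient: compare it with 𝟙 one degree lower.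
  ⊗≋𝟙-fromRecurrence : ∀ (c : ℕ → Carrier) a S → top S ≡.≡ 0 → c 0 ≈ 0# → c 1 ≈ 1# →
                       (∀ m → c (suc (suc m)) ≈ a * c (suc m) + conv (suc m) (cf S) (c ∘ suc)) →
                       mk 0 c ⊗ (Z ⊖ const a ⊖ S) ≋ 𝟙
  ⊗≋𝟙-fromRecurrence c a (mk .0 s) ≡.refl c0≈0 c1≈1 c-rec = mk-suc 0 _ (cf 𝟙) head tail
    where
    b : ℕ → Carrier
    b = cf (Z ⊖ const a ⊖ mk 0 s)
    b0≈1 : b 0 ≈ 1#
    b0≈1 = trans (+-identityʳ _) (+-identityʳ _)
    b-suc : ∀ k → b (suc k) ≈ - (cf (const a) k + s k)
    b-suc k = trans (+-cong (+-identityˡ _) refl) (-‿+-comm _ _)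
    head : conv 1 c b ≈ 0#
    head = conv-suc-head 0 c b c0≈0
    tail : ∀ k → conv (suc (suc k)) c b ≈ cf 𝟙 k
    tail zero    = trans (conv-suc-head 1 c b c0≈0)
                         (trans (+-identityˡ _) (trans (*-cong c1≈1 b0≈1) (*-identityˡ 1#)))
    tail (suc m) = begin
      conv (3 ℕ.+ m) c b
        ≈⟨ conv-suc-head (2 ℕ.+ m) c b c0≈0 ⟩
      conv (2 ℕ.+ m) (c ∘ suc) b
        ≈⟨ conv-comm (2 ℕ.+ m) (c ∘ suc) b ⟩
      conv (2 ℕ.+ m) b (c ∘ suc)
        ≈⟨ conv-peel (suc m) b (c ∘ suc) ⟩
      b 0 * c (2 ℕ.+ m) + conv (suc m) (b ∘ suc) (c ∘ suc)
        ≈⟨ +-cong (trans (*-cong b0≈1 refl) (*-identityˡ _))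
                  (conv-cong (suc m) b-suc (λ i → refl {c (suc i)})) ⟩
      c (2 ℕ.+ m) + conv (suc m) (λ k → - (cf (const a) k + s k)) (c ∘ suc)
        ≈⟨ +-cong refl (trans (conv-negˡ (suc m) _ (c ∘ suc))
                              (-‿cong (conv-+ˡ (suc m) (cf (const a)) s (c ∘ suc)))) ⟩
      c (2 ℕ.+ m) - (conv (suc m) (cf (const a)) (c ∘ suc) + conv (suc m) s (c ∘ suc))
        ≈⟨ +-cong refl (-‿cong (+-cong (conv-constˡ m a (c ∘ suc)) (refl {conv (suc m) s (c ∘ suc)}))) ⟩
      c (2 ℕ.+ m) - (a * c (suc m) + conv (suc m) s (c ∘ suc))
        ≈⟨ +-cong refl (-‿cong (sym (c-rec m))) ⟩
      c (2 ℕ.+ m) - c (2 ℕ.+ m)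
        ≈⟨ -‿inverseʳ _ ⟩
      0# ∎

  top-ΣL : ∀ (f : X → Ser) xs → (∀ x → top (f x) ≡.≡ 0) → top (ΣL (map f xs)) ≡.≡ 0
  top-ΣL f []       top≡0 = ≡.refl
  top-ΣL f (x ∷ xs) top≡0 rewrite top≡0 x | top-ΣL f xs top≡0 = ≡.refl

  cf-ΣL : ∀ (f : X → Ser) xs → (∀ x → top (f x) ≡.≡ 0) →
          ∀ k → cf (ΣL (map f xs)) k ≈ lsum (λ x → cf (f x) k) xs
  cf-ΣL f []       top≡0 zero    = refl
  cf-ΣL f []       top≡0 (suc k) = refl
  cf-ΣL f (x ∷ xs) top≡0 k rewrite top≡0 x | top-ΣL f xs top≡0 = +-cong refl (cf-ΣL f xs top≡0 k)

module Walks {c ℓ : Level} (R : CommutativeRing c ℓ) (p : ℕ)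
             (a : Fin (suc p) → ℤ → CommutativeRing.Carrier R) where
  open CommutativeRing R hiding (zero)
  open PathSeries R p a
  open Sums R
  open import Relation.Binary.Reasoning.Setoid setoid
  open import Algebra.Properties.CommutativeSemigroup *-commutativeSemigroup using (x∙yz≈y∙xz)

  when : Bool → Carrier → Carrier
  when B x = if B then x else 0#

  when-*ʳ : ∀ B x y → when B (x * y) ≈ x * when B y
  when-*ʳ true  x y = refl
  when-*ʳ false x y = sym (zeroʳ x)

  oneStep : ℤ → (ℤ → Carrier) → Carrier
  oneStep h F = lsum (λ s → stepWeight h s * F (h ℤ.+ Δ s)) (allSteps p)

  oneStep-cong : ∀ h {F G : ℤ → Carrier} → (∀ h′ → F h′ ≈ G h′) → oneStep h F ≈ oneStep h G
  oneStep-cong h F≈G = lsum-cong (allSteps p) (λ s → *-cong refl (F≈G _))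

  oneStep-+ : ∀ h (F G : ℤ → Carrier) → oneStep h (λ h′ → F h′ + G h′) ≈ oneStep h F + oneStep h G
  oneStep-+ h F G = trans (lsum-cong (allSteps p) (λ s → distribˡ _ _ _)) (lsum-+ _ _ (allSteps p))

  oneStep-*ˡ : ∀ h k (F : ℤ → Carrier) → oneStep h (λ h′ → k * F h′) ≈ k * oneStep h F
  oneStep-*ˡ h k F = trans (lsum-cong (allSteps p) (λ s → x∙yz≈y∙xz _ k _)) (lsum-*ˡ k _ (allSteps p))

  oneStep-lsum : ∀ h (F : X → ℤ → Carrier) xs →
                 oneStep h (λ h′ → lsum (λ x → F x h′) xs) ≈ lsum (λ x → oneStep h (F x)) xs
  oneStep-lsum h F xs =
    trans (lsum-cong (allSteps p) (λ s → sym (lsum-*ˡ _ _ xs))) (lsum-comm _ (allSteps p) xs)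

  conv-oneStepˡ : ∀ n h (F : ℕ → ℤ → Carrier) g →
                  conv n (λ k → oneStep h (F k)) g ≈ oneStep h (λ h′ → conv n (λ k → F k h′) g)
  conv-oneStepˡ n h F g =
    trans (conv-lsumˡ n _ g (allSteps p)) (lsum-cong (allSteps p) (λ s → conv-*ˡ n _ _ g))

  oneStep-expand : ∀ h F → oneStep h F ≈
    F (h ℤ.+ 1ℤ) + (stepWeight h (st zero) * F (h ℤ.+ Δ {p} (st zero))
                    + lsum (λ i → stepWeight h (st (suc i)) * F (h ℤ.+ Δ {p} (st (suc i)))) (allFin p))
  oneStep-expand h F = +-cong (*-identityˡ _) (+-cong refl (begin
    lsum f (map st (tabulate suc))       ≈⟨ lsum-map f st (tabulate suc) ⟩
    lsum (f ∘ st) (tabulate suc)         ≡⟨ ≡.cong (lsum (f ∘ st)) (ListP.map-tabulate (λ i → i) suc) ⟨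
    lsum (f ∘ st) (map suc (allFin p))   ≈⟨ lsum-map (f ∘ st) suc (allFin p) ⟩
    lsum (f ∘ st ∘ suc) (allFin p)       ∎))
    where
    f : Step p → Carrier
    f s = stepWeight h s * F (h ℤ.+ Δ s)

  W : ℤ → ℕ → ℤ → ℤ → Carrier
  W b zero    h e = when (does (h ≟ e) ∧ does (b ≤? h)) 1#
  W b (suc n) h e = when (does (b ≤? h)) (oneStep h (λ h′ → W b n h′ e))

  W-below : ∀ n b h e → ¬ b ℤ.≤ h → W b n h e ≈ 0#
  W-below zero    b h e b≰h rewrite dec-false (b ≤? h) b≰h | ∧-zeroʳ (does (h ≟ e)) = refl
  W-below (suc n) b h e b≰h rewrite dec-false (b ≤? h) b≰h = refl

  W-suc : ∀ n b h e → b ℤ.≤ h → W b (suc n) h e ≈ oneStep h (λ h′ → W b n h′ e)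
  W-suc n b h e b≤h rewrite dec-true (b ≤? h) b≤h = refl

  W-zero-≡ : ∀ b {h e} → h ≡ e → b ℤ.≤ h → W b 0 h e ≈ 1#
  W-zero-≡ b {h} {e} h≡e b≤h rewrite dec-true (h ≟ e) h≡e | dec-true (b ≤? h) b≤h = refl

  W-zero-≢ : ∀ b {h e} → h ≢ e → W b 0 h e ≈ 0#
  W-zero-≢ b {h} {e} h≢e rewrite dec-false (h ≟ e) h≢e = refl

  pathTerm : ∀ {n} → ℤ → ℤ → ℤ → Vec (Step p) n → Carrier
  pathTerm b h e γ = when (does (endHeight h γ ≟ e) ∧ does (b ≤? minHeight h γ)) (weight h γ)

  pathSum : ℤ → ℕ → ℤ → ℤ → Carrier
  pathSum b n h e = lsum (pathTerm b h e) (allPaths p n)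

  pathTerm-∷ : ∀ {n b h} e s (γ : Vec (Step p) n) → b ℤ.≤ h →
               pathTerm b h e (s ∷ γ) ≈ stepWeight h s * pathTerm b (h ℤ.+ Δ s) e γ
  pathTerm-∷ {b = b} {h} e s γ b≤h
    rewrite does-⇔ (mk⇔ (λ le → ℤP.≤-trans le (ℤP.i⊓j≤j h _)) (ℤP.⊓-glb b≤h))
                   (b ≤? h ⊓ minHeight (h ℤ.+ Δ s) γ) (b ≤? minHeight (h ℤ.+ Δ s) γ)
    = when-*ʳ _ _ _

  pathTerm-below : ∀ {n b h} e s (γ : Vec (Step p) n) → ¬ b ℤ.≤ h → pathTerm b h e (s ∷ γ) ≈ 0#
  pathTerm-below {b = b} {h} e s γ b≰h
    rewrite dec-false (b ≤? h ⊓ minHeight (h ℤ.+ Δ s) γ) (λ le → b≰h (ℤP.≤-trans le (ℤP.i⊓j≤i h _)))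
          | ∧-zeroʳ (does (endHeight (h ℤ.+ Δ s) γ ≟ e)) = refl

  pathSum≈W : ∀ n b h e → pathSum b n h e ≈ W b n h e
  pathSum≈W zero    b h e = +-identityʳ _
  pathSum≈W (suc n) b h e with b ≤? h
  ... | no b≰h = lsum-zero _ (allPaths p (suc n)) λ where (s ∷ γ) → pathTerm-below e s γ b≰h
  ... | yes b≤h = begin
    lsum (pathTerm b h e) (concatMap (λ s → map (s ∷_) (allPaths p n)) (allSteps p))
      ≈⟨ lsum-concatMap (pathTerm b h e) (λ s → map (s ∷_) (allPaths p n)) (allSteps p) ⟩
    lsum (λ s → lsum (pathTerm b h e) (map (s ∷_) (allPaths p n))) (allSteps p)
      ≈⟨ lsum-cong (allSteps p) (λ s → lsum-map _ (s ∷_) (allPaths p n)) ⟩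
    lsum (λ s → lsum (λ γ → pathTerm b h e (s ∷ γ)) (allPaths p n)) (allSteps p)
      ≈⟨ lsum-cong (allSteps p) (λ s → lsum-cong (allPaths p n) (λ γ → pathTerm-∷ e s γ b≤h)) ⟩
    lsum (λ s → lsum (λ γ → stepWeight h s * pathTerm b (h ℤ.+ Δ s) e γ) (allPaths p n)) (allSteps p)
      ≈⟨ lsum-cong (allSteps p) (λ s → trans (lsum-*ˡ _ _ (allPaths p n))
                                             (*-cong refl (pathSum≈W n b _ e))) ⟩
    oneStep h (λ h′ → W b n h′ e) ∎

  Acoef≈W : ∀ n j q → Acoef n j q ≈ W (+ q) n (+ q) (+ q ℤ.+ + toℕ j)
  Acoef≈W n j q = trans (lsum-cong (allPaths p n) shifted) (pathSum≈W n Q Q (Q ℤ.+ J))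
    where
    Q J : ℤ
    Q = + q
    J = + toℕ j
    shifted : ∀ γ → when (does (endHeight 0ℤ γ ≟ J) ∧ does (minHeight 0ℤ γ ≟ 0ℤ)) (weight Q γ)
                  ≈ pathTerm Q Q (Q ℤ.+ J) γ
    shifted γ = reflexive (≡.cong₂ (λ x y → when (x ∧ y) (weight Q γ))
      (does-⇔ (endHeight≡⇔ Q J γ) (endHeight 0ℤ γ ≟ J) (endHeight Q γ ≟ Q ℤ.+ J))
      (does-⇔ (minHeight≡0⇔ Q γ) (minHeight 0ℤ γ ≟ 0ℤ) (Q ≤? minHeight Q γ)))

  oneStep-fromFloor : ∀ n b e → oneStep b (λ h′ → W (b ℤ.+ 1ℤ) n h′ e) ≈ W (b ℤ.+ 1ℤ) n (b ℤ.+ 1ℤ) e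
  oneStep-fromFloor n b e = trans (oneStep-expand b (λ h′ → W (b ℤ.+ 1ℤ) n h′ e))
    (trans (+-cong refl (trans (+-cong (descent zero) (lsum-zero _ (allFin p) (descent ∘ suc)))
                               (+-identityʳ 0#)))
           (+-identityʳ _))
    where
    descent : ∀ j → stepWeight b (st j) * W (b ℤ.+ 1ℤ) n (b ℤ.+ Δ (st j)) e ≈ 0#
    descent j = trans (*-cong refl (W-below n (b ℤ.+ 1ℤ) _ e below)) (zeroʳ _)
      where
      below : ¬ (b ℤ.+ 1ℤ ℤ.≤ b ℤ.+ Δ (st j))
      below le = i+1≰i b (ℤP.≤-trans le (ℤP.i-j≤i b (+ toℕ j)))

  oneStep-aboveFloor : ∀ n {b h} e → b ℤ.≤ h → Dec (h ≡ b) →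
    oneStep h (λ h′ → W (b ℤ.+ 1ℤ) n h′ e)
      ≈ W (b ℤ.+ 1ℤ) (suc n) h e + W b 0 h b * W (b ℤ.+ 1ℤ) n (b ℤ.+ 1ℤ) e
  oneStep-aboveFloor n {b} e b≤b (yes ≡.refl) = begin
    oneStep b (λ h′ → W (b ℤ.+ 1ℤ) n h′ e)
      ≈⟨ oneStep-fromFloor n b e ⟩
    W (b ℤ.+ 1ℤ) n (b ℤ.+ 1ℤ) e
      ≈⟨ trans (*-cong (W-zero-≡ b ≡.refl b≤b) refl) (*-identityˡ _) ⟨
    W b 0 b b * W (b ℤ.+ 1ℤ) n (b ℤ.+ 1ℤ) e
      ≈⟨ trans (+-cong (W-below (suc n) (b ℤ.+ 1ℤ) b e (i+1≰i b)) refl) (+-identityˡ _) ⟨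
    W (b ℤ.+ 1ℤ) (suc n) b e + W b 0 b b * W (b ℤ.+ 1ℤ) n (b ℤ.+ 1ℤ) e ∎
  oneStep-aboveFloor n {b} {h} e b≤h (no h≢b) =
    trans (sym (W-suc n (b ℤ.+ 1ℤ) h e (≤∧≢⇒+1≤ b≤h h≢b)))
          (sym (trans (+-cong refl (trans (*-cong (W-zero-≢ b h≢b) refl) (zeroˡ _))) (+-identityʳ _)))

  -- A path that ends above b and visits level b has a last visit there, left by an up-step.
  W-lastExit : ∀ n b h e → b ℤ.+ 1ℤ ℤ.≤ e →
    W b n h e ≈ W (b ℤ.+ 1ℤ) n h e + conv n (λ l → W b l h b) (λ k → W (b ℤ.+ 1ℤ) k (b ℤ.+ 1ℤ) e)
  W-lastExit zero    b h e b+1≤e = trans (base (h ≟ e)) (sym (+-identityʳ _))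
    where
    base : Dec (h ≡ e) → W b 0 h e ≈ W (b ℤ.+ 1ℤ) 0 h e
    base (yes h≡e) =
      trans (W-zero-≡ b h≡e (ℤP.≤-trans (i≤i+1 b) b+1≤h)) (sym (W-zero-≡ (b ℤ.+ 1ℤ) h≡e b+1≤h))
      where b+1≤h = ≡.subst (λ x → b ℤ.+ 1ℤ ℤ.≤ x) (≡.sym h≡e) b+1≤e
    base (no h≢e)  = trans (W-zero-≢ b h≢e) (sym (W-zero-≢ (b ℤ.+ 1ℤ) h≢e))
  W-lastExit (suc n) b h e b+1≤e = step (b ≤? h)
    where
    b′ = b ℤ.+ 1ℤ
    f : ℤ → ℕ → Carrier
    f h′ l = W b l h′ b
    g : ℕ → Carrier
    g k = W b′ k b′ e
    step : Dec (b ℤ.≤ h) → W b (suc n) h e ≈ W b′ (suc n) h e + conv (suc n) (f h) g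
    step (no b≰h) = trans (W-below (suc n) b h e b≰h) (sym (trans
      (+-cong (W-below (suc n) b′ h e (λ le → b≰h (ℤP.≤-trans (i≤i+1 b) le)))
              (conv-zeroˡ (suc n) (f h) g (λ l → W-below l b h b b≰h)))
      (+-identityʳ 0#)))
    step (yes b≤h) = begin
      W b (suc n) h e
        ≈⟨ W-suc n b h e b≤h ⟩
      oneStep h (λ h′ → W b n h′ e)
        ≈⟨ oneStep-cong h (λ h′ → W-lastExit n b h′ e b+1≤e) ⟩
      oneStep h (λ h′ → W b′ n h′ e + conv n (f h′) g)
        ≈⟨ oneStep-+ h (λ h′ → W b′ n h′ e) (λ h′ → conv n (f h′) g) ⟩
      oneStep h (λ h′ → W b′ n h′ e) + oneStep h (λ h′ → conv n (f h′) g)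
        ≈⟨ +-cong (oneStep-aboveFloor n e b≤h (h ≟ b)) (sym (conv-oneStepˡ n h (λ l h′ → f h′ l) g)) ⟩
      (W b′ (suc n) h e + f h 0 * g n) + conv n (λ l → oneStep h (λ h′ → f h′ l)) g
        ≈⟨ +-cong refl (conv-cong n (λ l → sym (W-suc l b h b b≤h)) (λ _ → refl)) ⟩
      (W b′ (suc n) h e + f h 0 * g n) + conv n (f h ∘ suc) g
        ≈⟨ +-assoc _ _ _ ⟩
      W b′ (suc n) h e + (f h 0 * g n + conv n (f h ∘ suc) g)
        ≈⟨ +-cong refl (conv-peel n (f h) g) ⟨
      W b′ (suc n) h e + conv (suc n) (f h) g ∎

  launch : ℤ → Fin p → ℤ
  launch b i = b ℤ.+ + suc (toℕ i)

  viaFirstEntry : ℕ → ℤ → ℤ → Carrier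
  viaFirstEntry n b h =
    lsum (λ i → conv n (λ k → a (suc i) b * W (b ℤ.+ 1ℤ) k h (launch b i)) (λ l → W b l b b)) (allFin p)

  downStep-landing : ∀ {b h} X (i : Fin p) → b ℤ.+ 1ℤ ℤ.≤ h → Dec (h ≡ launch b i) →
    stepWeight h (st (suc i)) * (W b 0 (h ℤ.+ Δ (st (suc i))) b * X)
      ≈ (a (suc i) b * W (b ℤ.+ 1ℤ) 0 h (launch b i)) * X
  downStep-landing {b} {h} X i b+1≤h (yes h≡e) = begin
    a (suc i) (h ℤ.- k) * (W b 0 (h ℤ.- k) b * X)
      ≡⟨ ≡.cong (λ x → a (suc i) x * (W b 0 (h ℤ.- k) b * X)) h-k≡b ⟩
    a (suc i) b * (W b 0 (h ℤ.- k) b * X)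
      ≈⟨ *-cong refl (*-cong (W-zero-≡ b h-k≡b (ℤP.≤-reflexive (≡.sym h-k≡b))) refl) ⟩
    a (suc i) b * (1# * X)
      ≈⟨ *-assoc _ _ _ ⟨
    (a (suc i) b * 1#) * X
      ≈⟨ *-cong (*-cong refl (W-zero-≡ (b ℤ.+ 1ℤ) h≡e b+1≤h)) refl ⟨
    (a (suc i) b * W (b ℤ.+ 1ℤ) 0 h (launch b i)) * X ∎
    where
    k = + suc (toℕ i)
    h-k≡b : h ℤ.- k ≡ b
    h-k≡b = ≡.trans (≡.cong (ℤ._- k) h≡e) (//-rightDividesʳ k b)
  downStep-landing {b} {h} X i b+1≤h (no h≢e) =
    trans (trans (*-cong refl (trans (*-cong (W-zero-≢ b h-k≢b) refl) (zeroˡ _))) (zeroʳ _))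
          (sym (trans (*-cong (trans (*-cong refl (W-zero-≢ (b ℤ.+ 1ℤ) h≢e)) (zeroʳ _)) refl) (zeroˡ _)))
    where
    k = + suc (toℕ i)
    h-k≢b : h ℤ.- k ≢ b
    h-k≢b eq = h≢e (≡.trans (≡.sym (//-rightDividesˡ k h)) (≡.cong (ℤ._+ k) eq))

  oneStep-landing : ∀ b h X → b ℤ.+ 1ℤ ℤ.≤ h →
    oneStep h (λ h′ → W b 0 h′ b * X)
      ≈ lsum (λ i → (a (suc i) b * W (b ℤ.+ 1ℤ) 0 h (launch b i)) * X) (allFin p)
  oneStep-landing b h X b+1≤h = begin
    oneStep h (λ h′ → W b 0 h′ b * X)
      ≈⟨ oneStep-expand h (λ h′ → W b 0 h′ b * X) ⟩
    W b 0 (h ℤ.+ 1ℤ) b * X + (stepWeight h (st zero) * (W b 0 (h ℤ.+ Δ {p} (st zero)) b * X) + _)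
      ≈⟨ +-cong (vanish up-misses)
                (+-cong (trans (*-cong refl (vanish level-misses)) (zeroʳ _))
                        (lsum-cong (allFin p) (λ i → downStep-landing X i b+1≤h (h ≟ _)))) ⟩
    0# + (0# + lsum (λ i → (a (suc i) b * W (b ℤ.+ 1ℤ) 0 h (launch b i)) * X) (allFin p))
      ≈⟨ trans (+-identityˡ _) (+-identityˡ _) ⟩
    lsum (λ i → (a (suc i) b * W (b ℤ.+ 1ℤ) 0 h (launch b i)) * X) (allFin p) ∎
    where
    vanish : ∀ {h′} → h′ ≢ b → W b 0 h′ b * X ≈ 0#
    vanish h′≢b = trans (*-cong (W-zero-≢ b h′≢b) refl) (zeroˡ _)
    b<h : b ℤ.< h
    b<h = ℤP.suc[i]≤j⇒i<j (≡.subst (ℤ._≤ h) (ℤP.+-comm b 1ℤ) b+1≤h)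
    up-misses : h ℤ.+ 1ℤ ≢ b
    up-misses eq = ℤP.<⇒≱ b<h (≡.subst (h ℤ.≤_) eq (i≤i+1 h))
    level-misses : h ℤ.+ Δ {p} (st zero) ≢ b
    level-misses eq = ℤP.<⇒≢ b<h (≡.sym (≡.trans (≡.sym (ℤP.+-identityʳ h)) eq))

  -- A path from above b that ends at b first reaches level b by a down-step from some height b + i + 1.
  W-firstEntry : ∀ n b h → W b n h b ≈ W b 0 h b * W b n b b + viaFirstEntry n b h
  W-firstEntry zero b h = sym (trans
    (+-cong (trans (*-cong refl (W-zero-≡ b ≡.refl ℤP.≤-refl)) (*-identityʳ _))
            (lsum-zero _ (allFin p) (λ _ → refl)))
    (+-identityʳ _))
  W-firstEntry (suc n) b h = step (h ≟ b) (b ≤? h)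
    where
    b′ = b ℤ.+ 1ℤ
    g : ℕ → Carrier
    g l = W b l b b
    entryFrom : Fin p → ℕ → ℤ → Carrier
    entryFrom i k h′ = a (suc i) b * W b′ k h′ (launch b i)
    entry : Fin p → ℕ → Carrier
    entry i k = entryFrom i k h
    noEntry : ¬ (b′ ℤ.≤ h) → viaFirstEntry (suc n) b h ≈ 0#
    noEntry b′≰h = lsum-zero _ (allFin p) (λ i → conv-zeroˡ (suc n) (entry i) g
      (λ k → trans (*-cong refl (W-below k b′ h (launch b i) b′≰h)) (zeroʳ _)))
    notFirst : h ≢ b → W b 0 h b * W b (suc n) b b ≈ 0#
    notFirst h≢b = trans (*-cong (W-zero-≢ b h≢b) refl) (zeroˡ _)
    step : Dec (h ≡ b) → Dec (b ℤ.≤ h) →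
           W b (suc n) h b ≈ W b 0 h b * W b (suc n) b b + viaFirstEntry (suc n) b h
    step (yes h≡b) _ = sym (trans
      (+-cong (trans (*-cong (W-zero-≡ b h≡b (ℤP.≤-reflexive (≡.sym h≡b))) refl) (*-identityˡ _))
              (noEntry (λ le → i+1≰i b (≡.subst (b′ ℤ.≤_) h≡b le))))
      (trans (+-identityʳ _) (reflexive (≡.cong (λ x → W b (suc n) x b) (≡.sym h≡b)))))
    step (no h≢b) (no b≰h) = trans (W-below (suc n) b h b b≰h) (sym (trans
      (+-cong (notFirst h≢b) (noEntry (λ le → b≰h (ℤP.≤-trans (i≤i+1 b) le))))
      (+-identityʳ 0#)))
    step (no h≢b) (yes b≤h) = begin
      W b (suc n) h b
        ≈⟨ W-suc n b h b b≤h ⟩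
      oneStep h (λ h′ → W b n h′ b)
        ≈⟨ oneStep-cong h (λ h′ → W-firstEntry n b h′) ⟩
      oneStep h (λ h′ → W b 0 h′ b * g n + viaFirstEntry n b h′)
        ≈⟨ oneStep-+ h (λ h′ → W b 0 h′ b * g n) (viaFirstEntry n b) ⟩
      oneStep h (λ h′ → W b 0 h′ b * g n) + oneStep h (viaFirstEntry n b)
        ≈⟨ +-cong (oneStep-landing b h (g n) b′≤h) later ⟩
      lsum (λ i → entry i 0 * g n) (allFin p) + lsum (λ i → conv n (entry i ∘ suc) g) (allFin p)
        ≈⟨ lsum-+ (λ i → entry i 0 * g n) (λ i → conv n (entry i ∘ suc) g) (allFin p) ⟨
      lsum (λ i → entry i 0 * g n + conv n (entry i ∘ suc) g) (allFin p)
        ≈⟨ lsum-cong (allFin p) (λ i → conv-peel n (entry i) g) ⟨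
      viaFirstEntry (suc n) b h
        ≈⟨ trans (+-cong (notFirst h≢b) refl) (+-identityˡ _) ⟨
      W b 0 h b * W b (suc n) b b + viaFirstEntry (suc n) b h ∎
      where
      b′≤h : b′ ℤ.≤ h
      b′≤h = ≤∧≢⇒+1≤ b≤h h≢b
      entry-suc : ∀ i k → oneStep h (entryFrom i k) ≈ entry i (suc k)
      entry-suc i k = trans (oneStep-*ˡ h (a (suc i) b) (λ h′ → W b′ k h′ (launch b i)))
                            (*-cong refl (sym (W-suc k b′ h (launch b i) b′≤h)))
      later : oneStep h (viaFirstEntry n b) ≈ lsum (λ i → conv n (entry i ∘ suc) g) (allFin p)
      later = begin
        oneStep h (viaFirstEntry n b)
          ≈⟨ oneStep-lsum h (λ i h′ → conv n (λ k → entryFrom i k h′) g) (allFin p) ⟩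
        lsum (λ i → oneStep h (λ h′ → conv n (λ k → entryFrom i k h′) g)) (allFin p)
          ≈⟨ lsum-cong (allFin p) (λ i → conv-oneStepˡ n h (entryFrom i) g) ⟨
        lsum (λ i → conv n (λ k → oneStep h (entryFrom i k)) g) (allFin p)
          ≈⟨ lsum-cong (allFin p) (λ i → conv-cong n (λ k → entry-suc i k) (λ _ → refl)) ⟩
        lsum (λ i → conv n (entry i ∘ suc) g) (allFin p) ∎

module PathGeneratingFunctions {c ℓ : Level} (R : CommutativeRing c ℓ) (p : ℕ)
                               (a : Fin (ℕ.suc p) → ℤ → CommutativeRing.Carrier R) where
  open CommutativeRing R hiding (zero)
  open PathSeries R p a
  open Sums R
  open Walks R p a
  open import Relation.Binary.Reasoning.Setoid setoid

  A₀ : ℕ → Carrier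
  A₀ n = Acoef n zero 0

  A¹ : Fin p → ℕ → Carrier
  A¹ i n = Acoef n (inject₁ i) 1

  A₀≈W : ∀ n → A₀ n ≈ W 0ℤ n 0ℤ 0ℤ
  A₀≈W n = Acoef≈W n zero 0

  A¹≈W : ∀ i n → A¹ i n ≈ W 1ℤ n 1ℤ (launch 0ℤ i)
  A¹≈W i n = trans (Acoef≈W n (inject₁ i) 1)
                   (reflexive (≡.cong (λ x → W 1ℤ n 1ℤ (+ ℕ.suc x)) (toℕ-inject₁ i)))

  Aⱼ-conv : ∀ (i : Fin p) n → Acoef n (suc i) 0 ≈ conv n A₀ (A¹ i)
  Aⱼ-conv i n = begin
    Acoef n (suc i) 0
      ≈⟨ Acoef≈W n (suc i) 0 ⟩
    W 0ℤ n 0ℤ (launch 0ℤ i)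
      ≈⟨ W-lastExit n 0ℤ 0ℤ (launch 0ℤ i) (+≤+ (s≤s z≤n)) ⟩
    W 1ℤ n 0ℤ (launch 0ℤ i) + conv n (λ l → W 0ℤ l 0ℤ 0ℤ) (λ k → W 1ℤ k 1ℤ (launch 0ℤ i))
      ≈⟨ trans (+-cong (W-below n 1ℤ 0ℤ _ λ { (+≤+ ()) }) refl) (+-identityˡ _) ⟩
    conv n (λ l → W 0ℤ l 0ℤ 0ℤ) (λ k → W 1ℤ k 1ℤ (launch 0ℤ i))
      ≈⟨ conv-cong n A₀≈W (A¹≈W i) ⟨
    conv n A₀ (A¹ i) ∎

  Aⱼ≋A₀⊗A¹ : ∀ (i : Fin p) → Aser (suc i) 0 ≋ Aser zero 0 ⊗ Aser (inject₁ i) 1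
  Aⱼ≋A₀⊗A¹ i = ≋⊗-fromConv (cf (Aser zero 0)) (cf (Aser (inject₁ i) 1)) (cf (Aser (suc i) 0))
                           refl refl refl (Aⱼ-conv i)

  S : Ser
  S = ΣL (map (λ i → const (a (suc i) 0ℤ) ⊗ Aser (inject₁ i) 1) (allFin p))

  cf-S : ∀ k → cf S k ≈ lsum (λ i → a (suc i) 0ℤ * cf (Aser (inject₁ i) 1) k) (allFin p)
  cf-S k = trans (cf-ΣL _ (allFin p) (λ _ → ≡.refl) k)
                 (lsum-cong (allFin p) (λ i → conv-constˡ k (a (suc i) 0ℤ) (cf (Aser (inject₁ i) 1))))

  cf-S-0 : cf S 0 ≈ 0#
  cf-S-0 = trans (cf-S 0) (lsum-zero _ (allFin p) (λ i → zeroʳ (a (suc i) 0ℤ)))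

  conv-S≈viaFirstEntry : ∀ m → conv (ℕ.suc m) (cf S) A₀ ≈ viaFirstEntry m 0ℤ 1ℤ
  conv-S≈viaFirstEntry m = begin
    conv (ℕ.suc m) (cf S) A₀
      ≈⟨ conv-suc-head m (cf S) A₀ cf-S-0 ⟩
    conv m (cf S ∘ ℕ.suc) A₀
      ≈⟨ conv-cong m (λ k → trans (cf-S (ℕ.suc k)) (lsum-cong (allFin p) (λ i → *-cong refl (A¹≈W i k))))
                     A₀≈W ⟩
    conv m (λ k → lsum (λ i → a (suc i) 0ℤ * W 1ℤ k 1ℤ (launch 0ℤ i)) (allFin p)) (λ l → W 0ℤ l 0ℤ 0ℤ)
      ≈⟨ conv-lsumˡ m (λ i k → a (suc i) 0ℤ * W 1ℤ k 1ℤ (launch 0ℤ i)) _ (allFin p) ⟩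
    viaFirstEntry m 0ℤ 1ℤ ∎

  A₀-recurrence : ∀ m → A₀ (ℕ.suc m) ≈ a zero 0ℤ * A₀ m + conv (ℕ.suc m) (cf S) A₀
  A₀-recurrence m = begin
    A₀ (ℕ.suc m)
      ≈⟨ trans (A₀≈W (ℕ.suc m)) (W-suc m 0ℤ 0ℤ 0ℤ (+≤+ z≤n)) ⟩
    oneStep 0ℤ (λ h → W 0ℤ m h 0ℤ)
      ≈⟨ oneStep-expand 0ℤ (λ h → W 0ℤ m h 0ℤ) ⟩
    W 0ℤ m 1ℤ 0ℤ + (a zero 0ℤ * W 0ℤ m 0ℤ 0ℤ + _)
      ≈⟨ +-cong (W-firstEntry m 0ℤ 1ℤ)
                (trans (+-cong refl (lsum-zero _ (allFin p) belowFloor)) (+-identityʳ _)) ⟩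
    (W 0ℤ 0 1ℤ 0ℤ * W 0ℤ m 0ℤ 0ℤ + viaFirstEntry m 0ℤ 1ℤ) + a zero 0ℤ * W 0ℤ m 0ℤ 0ℤ
      ≈⟨ +-cong (trans (+-cong (trans (*-cong (W-zero-≢ 0ℤ {1ℤ} {0ℤ} λ ()) refl) (zeroˡ _)) refl)
                       (+-identityˡ _)) refl ⟩
    viaFirstEntry m 0ℤ 1ℤ + a zero 0ℤ * W 0ℤ m 0ℤ 0ℤ
      ≈⟨ +-comm _ _ ⟩
    a zero 0ℤ * W 0ℤ m 0ℤ 0ℤ + viaFirstEntry m 0ℤ 1ℤ
      ≈⟨ +-cong (*-cong refl (A₀≈W m)) (conv-S≈viaFirstEntry m) ⟨
    a zero 0ℤ * A₀ m + conv (ℕ.suc m) (cf S) A₀ ∎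
    where
    belowFloor : ∀ i → stepWeight 0ℤ (st (suc i)) * W 0ℤ m (0ℤ ℤ.+ Δ {p} (st (suc i))) 0ℤ ≈ 0#
    belowFloor i = trans (*-cong refl (W-below m 0ℤ _ 0ℤ λ ())) (zeroʳ _)

  A₀⊗denominator≋𝟙 : Aser zero 0 ⊗ (Z ⊖ const (a zero 0ℤ) ⊖ S) ≋ 𝟙
  A₀⊗denominator≋𝟙 =
    ⊗≋𝟙-fromRecurrence (cf (Aser zero 0)) (a zero 0ℤ) S (top-ΣL _ (allFin p) (λ _ → ≡.refl))
                       refl (trans (A₀≈W 0) (W-zero-≡ 0ℤ {0ℤ} ≡.refl (+≤+ z≤n))) A₀-recurrence

theorem1p3 : ∀ {c ℓ : Level} (R : CommutativeRing c ℓ) (p : ℕ) → 1 ≤ p →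
    (a : Fin (Data.Nat.suc p) → ℤ → CommutativeRing.Carrier R) →
    let open PathSeries R p a in
    (Aser zero 0 ⊗ (Z ⊖ const (a zero (+ 0))
        ⊖ ΣL (map (λ i → const (a (suc i) (+ 0)) ⊗ Aser (inject₁ i) 1) (allFin p))) ≋ 𝟙)
    × (∀ (i : Fin p) → Aser (suc i) 0 ≋ Aser zero 0 ⊗ Aser (inject₁ i) 1)
theorem1p3 R p _ a = A₀⊗denominator≋𝟙 , Aⱼ≋A₀⊗A¹
  where open PathGeneratingFunctions R p a
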